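{- Let $G$ be a finite group, let $H$ be a nontrivial subgroup of $G$, and let $x\in G$. Suppose that $HxH=Hx^{ -1}H=Hx$ and that $Hx$ contains an involution. Then for any integer $0\leqslant b\leqslant |H|$, there exist $b$ pairwise disjoint right transversals of $H$ in $HxH$ whose union is inverse-closed.
   Context: An involution is an element of order $2$. $HxH=\{hxh':h,h'\in H\}$ is a double coset; it is a union of right cosets of $H$. For a set $K$ of elements of $G$ that is a union of right cosets of $H$, a right transversal of $H$ in $K$ is a subset of $G$ formed by taking exactly one element from each right coset of $H$ contained in $K$. A subset $R$ is inverse-closed if $R^{ -1}=R$. -}

module Defs where

open import Level using (0ℓ)
open import Data.Nat using (ℕ)
open import Data.Fin using (Fin)
open import Data.Fin.Subset using (Subset) renaming (_∈_ to _∈ₛ_)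
open import Data.Product using (Σ; ∃; ∃-syntax; _×_; _,_)
open import Relation.Binary.PropositionalEquality using (_≡_; _≢_)
open import Relation.Nullary using (¬_)
open import Relation.Unary using (Pred; _⊆_)
open import Algebra.Structures using (IsGroup)

-- A finite group: a group structure on the finite set Fin order
-- (every finite group is isomorphic to one of this form).
record FiniteGroup : Set₁ where
  field
    order   : ℕ
    _∙_     : Fin order → Fin order → Fin order
    ε       : Fin order
    _⁻¹     : Fin order → Fin order
    isGroup : IsGroup _≡_ _∙_ ε _⁻¹
  infixl 7 _∙_
  infix 8 _⁻¹

module _ (G : FiniteGroup) where
  open FiniteGroup G

  private
    E = Fin order

  record IsSubgroup (H : Subset order) : Set where
    field
      ε∈    : ε ∈ₛ H
      ∙-closed : ∀ {a b} → a ∈ₛ H → b ∈ₛ H → a ∙ b ∈ₛ H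
      ⁻¹-closed : ∀ {a} → a ∈ₛ H → a ⁻¹ ∈ₛ H

  Nontrivial : Subset order → Set
  Nontrivial H = ∃[ h ] (h ∈ₛ H × h ≢ ε)

  RightCoset : Subset order → E → Pred E 0ℓ
  RightCoset H y z = ∃[ h ] (h ∈ₛ H × z ≡ h ∙ y)

  DoubleCoset : Subset order → E → Pred E 0ℓ
  DoubleCoset H y z = ∃[ h ] ∃[ h' ] (h ∈ₛ H × h' ∈ₛ H × z ≡ h ∙ y ∙ h')

  IsInvolution : E → Set
  IsInvolution t = t ≢ ε × t ∙ t ≡ ε

  IsRightTransversal : Subset order → Pred E 0ℓ → Subset order → Set
  IsRightTransversal H K T =
      (∀ t → t ∈ₛ T → ∃[ y ] (RightCoset H y ⊆ K × RightCoset H y t))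
    × (∀ y → RightCoset H y ⊆ K →
         ∃[ t ] (t ∈ₛ T × RightCoset H y t)
         × (∀ t t' → t ∈ₛ T → RightCoset H y t → t' ∈ₛ T → RightCoset H y t' → t ≡ t'))

  InverseSet : Pred E 0ℓ → Pred E 0ℓ
  InverseSet R z = ∃[ r ] (R r × z ≡ r ⁻¹)

  InverseClosed : Pred E 0ℓ → Set
  InverseClosed R = InverseSet R ⊆ R × R ⊆ InverseSet R

⋃ᶠ : ∀ {n b} → (Fin b → Subset n) → Pred (Fin n) 0ℓ
⋃ᶠ T z = ∃[ i ] (z ∈ₛ T i)

PairwiseDisjoint : ∀ {n b} → (Fin b → Subset n) → Set
PairwiseDisjoint {b = b} T = ∀ (i j : Fin b) → i ≢ j → ∀ z → z ∈ₛ T i → ¬ (z ∈ₛ T j)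

_≐ₚ_ : ∀ {n} → Pred (Fin n) 0ℓ → Pred (Fin n) 0ℓ → Set
A ≐ₚ B = A ⊆ B × B ⊆ A

-- Since HxH = Hx, the double coset is the single right coset Hx, so every
-- singleton {g} with g ∈ Hx is a right transversal of H in HxH, and b pairwise
-- disjoint transversals with inverse-closed union amount to b distinct elements
-- of Hx forming an inverse-closed set.  If t ∈ Hx is an involution then Hx = Ht
-- and (ht)⁻¹ = t h⁻¹ ∈ tH ⊆ HtH = Ht, so inversion is an involution of the
-- |H|-element set Ht fixing t.  Removing whole orbits (of size 1 or 2) of an
-- involution from a finite set reaches every size b or b + 1; the fixed point t
-- corrects the parity, so every size b ≤ |H| is attained exactly.
module Submission where

open import Defs
open import Data.Nat using (ℕ; _≤_)
open import Data.Fin using (Fin)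
open import Data.Fin.Subset using (Subset; ∣_∣)
open import Data.Product using (Σ; ∃; ∃-syntax; _×_; _,_)

open import Data.Nat using (zero; suc; _<_; z≤n; s≤s; _≤?_)
open import Data.Nat.Properties using (≤-antisym; ≤-pred; ≰⇒>; m≤n⇒m<n∨m≡n; n<1+n; m<n⇒m<1+n)
open import Data.Nat.Induction using (<-wellFounded)
open import Induction.WellFounded using (Acc; acc)
open import Data.Bool using (true; false)
open import Data.Vec.Base using ([]; _∷_; here; there)
import Data.Fin.Properties as Fin
open import Data.Fin.Subset using (⁅_⁆) renaming (_∈_ to _∈ₛ_)
open import Data.Fin.Subset.Properties using (x∈⁅x⁆; x∈⁅y⁆⇒x≡y)
open import Data.List using (List; []; _∷_; length; filter; map; lookup)
open import Data.List.Properties using (filter-all; filter-reject; length-map)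
open import Data.List.Membership.Propositional using (_∈_; _∉_)
open import Data.List.Membership.Propositional.Properties
  using (∈-filter⁺; ∈-filter⁻; ∈-map⁺; ∈-map⁻; ∈-lookup)
open import Data.List.Relation.Binary.Subset.Propositional using () renaming (_⊆_ to _⊆ᴸ_)
open import Data.List.Relation.Unary.Any using (here; there; index)
open import Data.List.Relation.Unary.Any.Properties using (lookup-index)
import Data.List.Relation.Unary.All as All
open import Data.List.Relation.Unary.AllPairs using ([]; _∷_)
open import Data.List.Relation.Unary.Unique.Propositional using (Unique)
import Data.List.Relation.Unary.Unique.Propositional.Properties as Unique
open import Data.Product using (proj₁; proj₂)
open import Data.Sum using (_⊎_; inj₁; inj₂)
open import Data.Empty using (⊥-elim)
open import Function using (_∘_; id; Injective)
open import Relation.Nullary using (¬?; yes; no)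
open import Relation.Unary using (Pred; _⊆_)
open import Relation.Binary.Definitions using (DecidableEquality)
open import Relation.Binary.PropositionalEquality
open import Algebra.Bundles using (Group)
open import Algebra.Structures using (IsGroup)
import Algebra.Properties.Group as GroupProperties

squeeze : ∀ {m b n} → m < b → b ≤ n → n ≡ suc m ⊎ n ≡ suc (suc m) → n ≡ b ⊎ n ≡ suc b
squeeze m<b b≤n (inj₁ refl) = inj₁ (≤-antisym m<b b≤n)
squeeze m<b b≤n (inj₂ refl) with m≤n⇒m<n∨m≡n b≤n
... | inj₁ (s≤s b≤1+m) = inj₂ (cong suc (≤-antisym m<b b≤1+m))
... | inj₂ b≡n        = inj₁ (sym b≡n)

one-or-two-more⇒< : ∀ {m n} → n ≡ suc m ⊎ n ≡ suc (suc m) → m < n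
one-or-two-more⇒< (inj₁ refl) = n<1+n _
one-or-two-more⇒< (inj₂ refl) = m<n⇒m<1+n (n<1+n _)

lookup-injective : ∀ {a} {A : Set a} {M : List A} → Unique M → Injective _≡_ _≡_ (lookup M)
lookup-injective {M = _ ∷ _} _ {Fin.zero} {Fin.zero} _ = refl
lookup-injective {M = _ ∷ _} (x∉ ∷ _) {Fin.zero} {Fin.suc j} eq = ⊥-elim (All.lookup x∉ (∈-lookup j) eq)
lookup-injective {M = _ ∷ _} (x∉ ∷ _) {Fin.suc i} {Fin.zero} eq = ⊥-elim (All.lookup x∉ (∈-lookup i) (sym eq))
lookup-injective {M = _ ∷ _} (_ ∷ u) {Fin.suc i} {Fin.suc j} eq = cong Fin.suc (lookup-injective u eq)

module InvolutionClosed {a} {A : Set a} (_≟_ : DecidableEquality A)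
                        (σ : A → A) (σ-involutive : ∀ x → σ (σ x) ≡ x) where

  Closed : List A → Set a
  Closed L = ∀ {x} → x ∈ L → σ x ∈ L

  ClosedSubset : List A → (ℕ → Set) → Set a
  ClosedSubset L P = ∃[ M ] (M ⊆ᴸ L × Unique M × Closed M × P (length M))

  closedSubset-mono : ∀ {L L′ P} → L′ ⊆ᴸ L → ClosedSubset L′ P → ClosedSubset L P
  closedSubset-mono L′⊆L (M , M⊆L′ , uM , cM , pM) = M , L′⊆L ∘ M⊆L′ , uM , cM , pM

  σ-injective : ∀ {x y} → σ x ≡ σ y → x ≡ y
  σ-injective {x} {y} eq = trans (sym (σ-involutive x)) (trans (cong σ eq) (σ-involutive y))

  remove : A → List A → List A
  remove x = filter (λ y → ¬? (y ≟ x))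

  ∈-remove⁻ : ∀ {x y L} → y ∈ remove x L → y ∈ L × y ≢ x
  ∈-remove⁻ = ∈-filter⁻ (λ y → ¬? (y ≟ _))

  ∈-remove⁺ : ∀ {x y L} → y ∈ L → y ≢ x → y ∈ remove x L
  ∈-remove⁺ = ∈-filter⁺ (λ y → ¬? (y ≟ _))

  remove-unique : ∀ {x L} → Unique L → Unique (remove x L)
  remove-unique = Unique.filter⁺ (λ y → ¬? (y ≟ _))

  remove-∉ : ∀ {x L} → x ∉ L → remove x L ≡ L
  remove-∉ {x} {L} x∉L =
    filter-all (λ y → ¬? (y ≟ x)) (All.tabulate (λ y∈L y≡x → x∉L (subst (_∈ L) y≡x y∈L)))

  length-remove : ∀ {x L} → Unique L → x ∈ L → length L ≡ suc (length (remove x L))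
  length-remove {x} {_ ∷ L} u (here refl) =
    cong (suc ∘ length) (sym (trans (filter-reject (λ y → ¬? (y ≟ x)) (λ x≢x → x≢x refl))
                                    (remove-∉ (Unique.Unique[x∷xs]⇒x∉xs u))))
  length-remove {x} {y ∷ L} u@(_ ∷ uL) (there x∈L) with y ≟ x
  ... | yes refl = ⊥-elim (Unique.Unique[x∷xs]⇒x∉xs u x∈L)
  ... | no _     = cong suc (length-remove uL x∈L)

  removeOrbit : A → List A → List A
  removeOrbit x L = remove (σ x) (remove x L)

  ∈-removeOrbit⁻ : ∀ {x y L} → y ∈ removeOrbit x L → y ∈ L × y ≢ x × y ≢ σ x
  ∈-removeOrbit⁻ y∈ with ∈-remove⁻ y∈
  ... | y∈′ , y≢σx with ∈-remove⁻ y∈′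
  ...   | y∈L , y≢x = y∈L , y≢x , y≢σx

  ∈-removeOrbit⁺ : ∀ {x y L} → y ∈ L → y ≢ x → y ≢ σ x → y ∈ removeOrbit x L
  ∈-removeOrbit⁺ y∈L y≢x y≢σx = ∈-remove⁺ (∈-remove⁺ y∈L y≢x) y≢σx

  removeOrbit-⊆ : ∀ {x L} → removeOrbit x L ⊆ᴸ L
  removeOrbit-⊆ = proj₁ ∘ ∈-removeOrbit⁻

  removeOrbit-unique : ∀ {x L} → Unique L → Unique (removeOrbit x L)
  removeOrbit-unique = remove-unique ∘ remove-unique

  removeOrbit-closed : ∀ {x L} → Closed L → Closed (removeOrbit x L)
  removeOrbit-closed c {y} y∈ with ∈-removeOrbit⁻ y∈
  ... | y∈L , y≢x , y≢σx =
    ∈-removeOrbit⁺ (c y∈L)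
      (λ σy≡x → y≢σx (trans (sym (σ-involutive y)) (cong σ σy≡x)))
      (λ σy≡σx → y≢x (σ-injective σy≡σx))

  length-removeOrbit-fixed : ∀ {x L} → Unique L → x ∈ L → σ x ≡ x →
                             length L ≡ suc (length (removeOrbit x L))
  length-removeOrbit-fixed {x} {L} u x∈L σx≡x = begin
    length L                          ≡⟨ length-remove u x∈L ⟩
    suc (length (remove x L))         ≡⟨ cong (suc ∘ length) (sym (remove-∉ σx∉)) ⟩
    suc (length (removeOrbit x L))    ∎
    where
    open ≡-Reasoning
    σx∉ : σ x ∉ remove x L
    σx∉ σx∈ = proj₂ (∈-remove⁻ {L = L} σx∈) σx≡x

  length-removeOrbit-moved : ∀ {x L} → Unique L → Closed L → x ∈ L → σ x ≢ x →
                             length L ≡ suc (suc (length (removeOrbit x L)))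
  length-removeOrbit-moved u c x∈L σx≢x =
    trans (length-remove u x∈L)
          (cong suc (length-remove (remove-unique u) (∈-remove⁺ (c x∈L) σx≢x)))

  length-removeOrbit : ∀ {x L} → Unique L → Closed L → x ∈ L →
                       length L ≡ suc (length (removeOrbit x L))
                     ⊎ length L ≡ suc (suc (length (removeOrbit x L)))
  length-removeOrbit {x} u c x∈L with σ x ≟ x
  ... | yes σx≡x = inj₁ (length-removeOrbit-fixed u x∈L σx≡x)
  ... | no  σx≢x = inj₂ (length-removeOrbit-moved u c x∈L σx≢x)

  closedSubset-≈ : ∀ {L} → Unique L → Closed L → ∀ {b} → b ≤ length L →
                   ClosedSubset L (λ m → m ≡ b ⊎ m ≡ suc b)
  closedSubset-≈ {L} = go L (<-wellFounded (length L))
    where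
    go : ∀ L → Acc _<_ (length L) → Unique L → Closed L → ∀ {b} → b ≤ length L →
         ClosedSubset L (λ m → m ≡ b ⊎ m ≡ suc b)
    go [] _ _ _ z≤n = [] , id , [] , (λ ()) , inj₁ refl
    go L@(x ∷ _) (acc smaller) u c {b} b≤L
      with length-removeOrbit u c (here refl) | b ≤? length (removeOrbit x L)
    ... | len | yes b≤L′ =
      closedSubset-mono {P = λ m → m ≡ b ⊎ m ≡ suc b} removeOrbit-⊆
        (go _ (smaller (one-or-two-more⇒< len)) (removeOrbit-unique u) (removeOrbit-closed c) b≤L′)
    ... | len | no b≰L′ = L , id , u , c , squeeze (≰⇒> b≰L′) b≤L len

  -- A fixed point z fills the gap when removing orbits overshoots by one.
  closedSubset-exact : ∀ {L z} → Unique L → Closed L → z ∈ L → σ z ≡ z →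
                       ∀ {b} → b ≤ length L → ClosedSubset L (_≡ b)
  closedSubset-exact _ _ _ _ {zero} _ = [] , (λ ()) , [] , (λ ()) , refl
  closedSubset-exact {L} {z} u c z∈L σz≡z {suc b} b<L
    with closedSubset-≈ (removeOrbit-unique u) (removeOrbit-closed c)
           (≤-pred (subst (suc b ≤_) (length-removeOrbit-fixed u z∈L σz≡z) b<L))
  ... | M , M⊆ , uM , cM , inj₂ |M|≡1+b = M , removeOrbit-⊆ ∘ M⊆ , uM , cM , |M|≡1+b
  ... | M , M⊆ , uM , cM , inj₁ |M|≡b = z ∷ M , z∷M⊆L , z∉M ∷ uM , z∷M-closed , cong suc |M|≡b
    where
    z∉M : All.All (z ≢_) M
    z∉M = All.tabulate (λ y∈M z≡y → proj₁ (proj₂ (∈-removeOrbit⁻ {L = L} (M⊆ y∈M))) (sym z≡y))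
    z∷M⊆L : z ∷ M ⊆ᴸ L
    z∷M⊆L (here refl) = z∈L
    z∷M⊆L (there y∈M) = removeOrbit-⊆ (M⊆ y∈M)
    z∷M-closed : Closed (z ∷ M)
    z∷M-closed (here refl) = here σz≡z
    z∷M-closed (there y∈M) = there (cM y∈M)

  closed-injection : ∀ {L z} → Unique L → Closed L → z ∈ L → σ z ≡ z →
                     ∀ {b} → b ≤ length L →
                     ∃[ f ] (Injective _≡_ _≡_ f × (∀ i → f i ∈ L) × (∀ (i : Fin b) → ∃[ j ] σ (f i) ≡ f j))
  closed-injection u c z∈L σz≡z b≤L with closedSubset-exact u c z∈L σz≡z b≤L
  ... | M , M⊆L , uM , cM , refl =
    lookup M , lookup-injective uM , M⊆L ∘ ∈-lookup ,
    λ i → index (cM (∈-lookup i)) , lookup-index (cM (∈-lookup i))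

elements : ∀ {n} → Subset n → List (Fin n)
elements []            = []
elements (true  ∷ p) = Fin.zero ∷ map Fin.suc (elements p)
elements (false ∷ p) = map Fin.suc (elements p)

length-elements : ∀ {n} (p : Subset n) → length (elements p) ≡ ∣ p ∣
length-elements []          = refl
length-elements (true  ∷ p) = cong suc (trans (length-map Fin.suc (elements p)) (length-elements p))
length-elements (false ∷ p) = trans (length-map Fin.suc (elements p)) (length-elements p)

∈-elements⁻ : ∀ {n} {p : Subset n} {x} → x ∈ elements p → x ∈ₛ p
∈-elements⁻ {p = true ∷ p} (here refl) = here
∈-elements⁻ {p = true ∷ p} (there x∈) with ∈-map⁻ Fin.suc x∈
... | _ , y∈ , refl = there (∈-elements⁻ y∈)
∈-elements⁻ {p = false ∷ p} x∈ with ∈-map⁻ Fin.suc x∈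
... | _ , y∈ , refl = there (∈-elements⁻ y∈)

∈-elements⁺ : ∀ {n} {p : Subset n} {x} → x ∈ₛ p → x ∈ elements p
∈-elements⁺ {p = true  ∷ p} here        = here refl
∈-elements⁺ {p = true  ∷ p} (there x∈p) = there (∈-map⁺ Fin.suc (∈-elements⁺ x∈p))
∈-elements⁺ {p = false ∷ p} (there x∈p) = ∈-map⁺ Fin.suc (∈-elements⁺ x∈p)

elements-unique : ∀ {n} (p : Subset n) → Unique (elements p)
elements-unique []          = []
elements-unique (true  ∷ p) =
  All.tabulate (λ x∈ → zero≢suc (proj₂ (proj₂ (∈-map⁻ Fin.suc x∈)))) ∷
  Unique.map⁺ Fin.suc-injective (elements-unique p)
  where
  zero≢suc : ∀ {n} {x : Fin (suc n)} {y : Fin n} → x ≡ Fin.suc y → Fin.zero ≢ x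
  zero≢suc refl ()
elements-unique (false ∷ p) = Unique.map⁺ Fin.suc-injective (elements-unique p)

singletons-disjoint : ∀ {n b} {f : Fin b → Fin n} → Injective _≡_ _≡_ f → PairwiseDisjoint (⁅_⁆ ∘ f)
singletons-disjoint {f = f} f-injective i j i≢j z z∈i z∈j =
  i≢j (f-injective (trans (sym (x∈⁅y⁆⇒x≡y (f i) z∈i)) (x∈⁅y⁆⇒x≡y (f j) z∈j)))

module FiniteGroupLemmas (G : FiniteGroup) where
  open FiniteGroup G
  open IsGroup isGroup using (assoc; identityˡ; identityʳ)

  group : Group _ _
  group = record { isGroup = isGroup }

  open GroupProperties group using (\\-leftDividesʳ; ⁻¹-involutive; ⁻¹-anti-homo-∙; ∙-cancelʳ)

  inverseClosed : ∀ {R : Pred (Fin order) _} → InverseSet G R ⊆ R → InverseClosed G R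
  inverseClosed R⁻¹⊆R = R⁻¹⊆R , λ {z} z∈R → z ⁻¹ , R⁻¹⊆R (z , z∈R , refl) , sym (⁻¹-involutive z)

  singletons-inverseClosed : ∀ {b} {f : Fin b → Fin order} → (∀ i → ∃[ j ] f i ⁻¹ ≡ f j) →
                             InverseClosed G (⋃ᶠ (⁅_⁆ ∘ f))
  singletons-inverseClosed {f = f} f-inverse = inverseClosed R⁻¹⊆R
    where
    R⁻¹⊆R : InverseSet G (⋃ᶠ (⁅_⁆ ∘ f)) ⊆ ⋃ᶠ (⁅_⁆ ∘ f)
    R⁻¹⊆R (r , (i , r∈) , refl) with f-inverse i
    ... | j , fi⁻¹≡fj = j , subst (_∈ₛ ⁅ f j ⁆) (sym (trans (cong _⁻¹ (x∈⁅y⁆⇒x≡y (f i) r∈)) fi⁻¹≡fj)) (x∈⁅x⁆ (f j))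

  module RightCosets {H : Subset order} (H≤G : IsSubgroup G H) where
    open IsSubgroup H≤G

    rightCoset-refl : ∀ x → RightCoset G H x x
    rightCoset-refl x = ε , ε∈ , sym (identityˡ x)

    rightCoset-sym : ∀ {x y} → RightCoset G H x y → RightCoset G H y x
    rightCoset-sym {x} (h , h∈ , refl) = h ⁻¹ , ⁻¹-closed h∈ , sym (\\-leftDividesʳ h x)

    rightCoset-trans : ∀ {x y z} → RightCoset G H x y → RightCoset G H y z → RightCoset G H x z
    rightCoset-trans {x} (h , h∈ , refl) (k , k∈ , refl) = k ∙ h , ∙-closed k∈ h∈ , sym (assoc k h x)

    rightCoset⊆doubleCoset : ∀ x → RightCoset G H x ⊆ DoubleCoset G H x
    rightCoset⊆doubleCoset x (h , h∈ , refl) = h , ε , h∈ , ε∈ , sym (identityʳ (h ∙ x))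

    rightCoset-inverse : ∀ {t} → t ⁻¹ ≡ t → (∀ {h} → h ∈ₛ H → RightCoset G H t (t ∙ h)) →
                         ∀ {z} → RightCoset G H t z → RightCoset G H t (z ⁻¹)
    rightCoset-inverse {t} t⁻¹≡t tH⊆Ht (h , h∈ , refl) =
      subst (RightCoset G H t) (sym (trans (⁻¹-anti-homo-∙ h t) (cong (_∙ h ⁻¹) t⁻¹≡t)))
            (tH⊆Ht (⁻¹-closed h∈))

    cosetList : Fin order → List (Fin order)
    cosetList y = map (_∙ y) (elements H)

    ∈-cosetList⁻ : ∀ {y z} → z ∈ cosetList y → RightCoset G H y z
    ∈-cosetList⁻ {y} z∈ with ∈-map⁻ (_∙ y) z∈
    ... | h , h∈ , z≡hy = h , ∈-elements⁻ h∈ , z≡hy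

    ∈-cosetList⁺ : ∀ {y z} → RightCoset G H y z → z ∈ cosetList y
    ∈-cosetList⁺ (h , h∈ , refl) = ∈-map⁺ _ (∈-elements⁺ h∈)

    cosetList-unique : ∀ y → Unique (cosetList y)
    cosetList-unique y = Unique.map⁺ (∙-cancelʳ y _ _) (elements-unique H)

    length-cosetList : ∀ y → length (cosetList y) ≡ ∣ H ∣
    length-cosetList y = trans (length-map (_∙ y) (elements H)) (length-elements H)

    singleton-isRightTransversal : ∀ {x g} → DoubleCoset G H x ⊆ RightCoset G H x →
                                   RightCoset G H x g →
                                   IsRightTransversal G H (DoubleCoset G H x) ⁅ g ⁆
    singleton-isRightTransversal {x} {g} HxH⊆Hx g∈Hx =
      (λ w w∈ → x , rightCoset⊆doubleCoset x , subst (RightCoset G H x) (sym (x∈⁅y⁆⇒x≡y g w∈)) g∈Hx) ,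
      λ y Hy⊆HxH →
        let y∈Hx = HxH⊆Hx (Hy⊆HxH (rightCoset-refl y)) in
        g , (x∈⁅x⁆ g , rightCoset-trans (rightCoset-sym y∈Hx) g∈Hx) ,
        λ w w′ w∈ _ w′∈ _ → trans (x∈⁅y⁆⇒x≡y g w∈) (sym (x∈⁅y⁆⇒x≡y g w′∈))

lemma3p4 : (G : FiniteGroup) → let open FiniteGroup G in
    (H : Subset order) → IsSubgroup G H → Nontrivial G H →
    (x : Fin order) →
    DoubleCoset G H x ≐ₚ DoubleCoset G H (x ⁻¹) →
    DoubleCoset G H (x ⁻¹) ≐ₚ RightCoset G H x →
    (∃[ t ] (RightCoset G H x t × IsInvolution G t)) →
    (b : ℕ) → b ≤ ∣ H ∣ →
    ∃[ T ] ((∀ (i : Fin b) → IsRightTransversal G H (DoubleCoset G H x) (T i))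
    × PairwiseDisjoint T
    × InverseClosed G (⋃ᶠ T))
lemma3p4 G H H≤G _ x (HxH⊆Hx⁻¹H , _) (Hx⁻¹H⊆Hx , _) (t , t∈Hx@(h₀ , h₀∈ , t≡h₀x) , _ , t∙t≡ε) b b≤∣H∣ =
  let f , f-injective , f∈Ht , f-inverse =
        closed-injection (cosetList-unique t) cosetList-closed (∈-cosetList⁺ (rightCoset-refl t)) t⁻¹≡t
          (subst (b ≤_) (sym (length-cosetList t)) b≤∣H∣)
  in
  ⁅_⁆ ∘ f ,
  (λ i → singleton-isRightTransversal (Hx⁻¹H⊆Hx ∘ HxH⊆Hx⁻¹H) (rightCoset-trans t∈Hx (∈-cosetList⁻ (f∈Ht i)))) ,
  singletons-disjoint f-injective ,
  singletons-inverseClosed f-inverse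
  where
  open FiniteGroup G
  open FiniteGroupLemmas G
  open RightCosets H≤G
  open GroupProperties group using (inverseˡ-unique; ⁻¹-involutive)
  open InvolutionClosed Fin._≟_ _⁻¹ ⁻¹-involutive

  t⁻¹≡t : t ⁻¹ ≡ t
  t⁻¹≡t = sym (inverseˡ-unique t t t∙t≡ε)

  tH⊆Ht : ∀ {h} → h ∈ₛ H → RightCoset G H t (t ∙ h)
  tH⊆Ht {h} h∈ = rightCoset-trans (rightCoset-sym t∈Hx) (Hx⁻¹H⊆Hx (HxH⊆Hx⁻¹H (h₀ , h , h₀∈ , h∈ , cong (_∙ h) t≡h₀x)))

  cosetList-closed : Closed (cosetList t)
  cosetList-closed = ∈-cosetList⁺ ∘ rightCoset-inverse t⁻¹≡t tH⊆Ht ∘ ∈-cosetList⁻
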